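{- Let $\mathbb{K}=(G,M,I)$ be a finite formal context and let $BC(\mathbb{K})$ be the formal context \[BC(\mathbb{K})=\Big(G\cup\overline{\mathcal{M}(M)},\ M,\ I\cup\{(\overline{m},n)\in\overline{\mathcal{M}(M)}\times M\mid m\not\geq_{\mathbb{K}} n\}\Big).\] Then the concept lattice of $BC(\mathbb{K})$ is isomorphic to the Birkhoff completion $(\mathcal{F}(\mathcal{M}(L)),\supseteq)$ of the concept lattice $L=\underline{\mathfrak{B}}(\mathbb{K})$ of $\mathbb{K}$.
   Context: For a formal context $(G,M,I)$ with $I\subseteq G\times M$, derivation operators are $A'=\{m\in M\mid \forall g\in A:(g,m)\in I\}$ for $A\subseteq G$ and $B'=\{g\in G\mid\forall m\in B:(g,m)\in I\}$ for $B\subseteq M$; a formal concept is a pair $(A,B)$ with $A'=B$, $B'=A$, and concepts are ordered by inclusion of their first components, giving the concept lattice $\underline{\mathfrak{B}}(\mathbb{K})$. The attribute concept of $m\in M$ is $\mu m=(m',m'')$ (writing $m'$ for $\{m\}'$). For $m,n\in M$, $m\geq_{\mathbb{K}} n$ means $\{m\}'\supseteq\{n\}'$, and $m\not\geq_{\mathbb{K}} n$ is its negation. $\mathcal{M}(M)$ is the set of meet-irreducible attributes of $\mathbb{K}$, i.e. those $m\in M$ whose attribute concept $\mu m$ is meet-irreducible in $\underline{\mathfrak{B}}(\mathbb{K})$; $\overline{\mathcal{M}(M)}=\{\overline{m}\mid m\in\mathcal{M}(M)\}$ is a set of new objects (copies), disjoint from $G$. For a finite lattice $L$, $\mathcal{M}(L)$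 is its set of meet-irreducible elements ($x$ with $\bigwedge X=x\Rightarrow x\in X$ for all $X\subseteq L$), ordered as in $L$, and $(\mathcal{F}(\mathcal{M}(L)),\supseteq)$ is the set of order filters (up-sets) of $\mathcal{M}(L)$ ordered by reverse inclusion. -}

module Defs where

open import Data.Bool using (Bool; true; false; T)
open import Data.Nat using (ℕ)
open import Data.Fin using (Fin)
open import Data.Fin.Properties using (all?)
open import Data.Product using (Σ; _×_; _,_; proj₁; proj₂)
open import Data.Sum using (_⊎_; inj₁; inj₂)
open import Relation.Nullary using (¬_; Dec; yes; no)
open import Relation.Nullary.Decidable using (⌊_⌋; _→-dec_; toWitness; fromWitness)
open import Relation.Nullary.Decidable.Core using (T?)
open import Relation.Binary.PropositionalEquality using (_≡_; refl)
open import Function using (_⇔_; mk⇔)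

-- Formal contexts (G, M, I).  Subsets of G and M are Bool-valued
-- (decidable) predicates; derivation operators are Set-valued.

record Context : Set₁ where
  field
    G : Set
    M : Set
    I : G → M → Set

module _ (K : Context) where
  open Context K

  _′ᴳ : (G → Bool) → M → Set
  (A ′ᴳ) m = ∀ g → T (A g) → I g m

  _′ᴹ : (M → Bool) → G → Set
  (B ′ᴹ) g = ∀ m → T (B m) → I g m

  record Concept : Set where
    constructor concept
    field
      ext   : G → Bool
      int   : M → Bool
      ext′≡int : ∀ m → T (int m) ⇔ (ext ′ᴳ) m
      int′≡ext : ∀ g → T (ext g) ⇔ (int ′ᴹ) g

  open Concept

  _≤_ : Concept → Concept → Set
  x ≤ y = ∀ g → T (ext x g) → T (ext y g)

  _≈_ : Concept → Concept → Set
  x ≈ y = (x ≤ y) × (y ≤ x)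

  -- subsets of the (finite) concept lattice: predicates respecting ≈
  Respects : (Concept → Bool) → Set
  Respects X = ∀ x y → x ≈ y → X x ≡ X y

  IsMeet : (Concept → Bool) → Concept → Set
  IsMeet X x = (∀ y → T (X y) → x ≤ y)
             × (∀ z → (∀ y → T (X y) → z ≤ y) → z ≤ x)

  IsMeetIrr : Concept → Set
  IsMeetIrr x = ∀ (X : Concept → Bool) → Respects X → IsMeet X x → T (X x)

Ctx : (g m : ℕ) → (Fin g → Fin m → Bool) → Context
Ctx g m I = record { G = Fin g ; M = Fin m ; I = λ x n → T (I x n) }

module _ {g m : ℕ} (I : Fin g → Fin m → Bool) where

  private K = Ctx g m I

  _≥K_ : Fin m → Fin m → Set
  k ≥K n = ∀ x → T (I x n) → T (I x k)

  private
    ≥K? : ∀ k n → Dec (k ≥K n)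
    ≥K? k n = all? (λ x → T? (I x n) →-dec T? (I x k))

  μ : Fin m → Concept K
  μ k = concept (λ x → I x k) (λ n → ⌊ ≥K? n k ⌋) e₁ e₂
    where
      e₁ : ∀ n → T ⌊ ≥K? n k ⌋ ⇔ (∀ x → T (I x k) → T (I x n))
      e₁ n = mk⇔ toWitness fromWitness
      e₂ : ∀ x → T (I x k) ⇔ (∀ n → T ⌊ ≥K? n k ⌋ → T (I x n))
      e₂ x = mk⇔ (λ h n t → toWitness t x h)
                 (λ f → f k (fromWitness (λ _ h → h)))

  IsMIAttr : Fin m → Set
  IsMIAttr k = IsMeetIrr K (μ k)

  BC : Context
  BC = record
    { G = Fin g ⊎ Σ (Fin m) IsMIAttr
    ; M = Fin m
    ; I = λ { (inj₁ x) n → T (I x n)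
            ; (inj₂ (k , _)) n → ¬ (k ≥K n) }
    }

  MIL : Set
  MIL = Σ (Concept K) (IsMeetIrr K)

  _≤MIL_ : MIL → MIL → Set
  a ≤MIL b = _≤_ K (proj₁ a) (proj₁ b)

  record Filter : Set where
    field
      mem  : MIL → Bool
      up   : ∀ a b → T (mem a) → a ≤MIL b → T (mem b)

  open Filter

  _⊇_ : Filter → Filter → Set
  F₁ ⊇ F₂ = ∀ a → T (mem F₂ a) → T (mem F₁ a)

-- Order isomorphism between preordered sets (isomorphism of the
-- induced posets): an order embedding that is surjective up to the
-- induced equivalence.

record OrderIso {A B : Set} (_≤A_ : A → A → Set) (_≤B_ : B → B → Set) : Set where
  field
    to      : A → B
    mono    : ∀ x y → x ≤A y → to x ≤B to y
    reflect : ∀ x y → to x ≤B to y → x ≤A y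
    onto    : ∀ b → Σ A (λ a → (to a ≤B b) × (b ≤B to a))

{-# OPTIONS --safe #-}
module Submission where

-- A concept of BC(K) is sent to the filter of M(L) generated by the attribute
-- concepts μn of its intent.  Conversely, a filter F comes from the concept of
-- BC(K) generated by the copies k̄ of the meet-irreducible μk ∉ F; its intent,
-- the n with no such μk above μn, is already closed.
--
-- Everything rests on a separation criterion in the finite lattice L: a concept
-- c is meet-irreducible iff some object a lies outside c but inside every
-- attribute concept strictly above c.  This makes meet-irreducibility
-- decidable, and, applied to a maximal attribute extent above n avoiding a,
-- it gives, for every object a without attribute n, a meet-irreducible μk ≥ μn
-- such that a lacks k too.
-- That is what makes the map reflect the order at the objects of G; at the
-- copies k̄ it does so by construction.  Finally, every meet-irreducible c is
-- the meet of the μn with n in its intent, hence equivalent to one of them.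

open import Defs
open import Data.Nat using (ℕ)
open import Data.Fin using (Fin)
open import Data.Bool using (Bool; T)

open import Data.Fin.Induction using (po-noetherian)
open import Data.Fin.Properties using (all?; any?)
open import Data.Product using (Σ; ∃; _×_; _,_; proj₁; proj₂; swap)
open import Data.Sum using (inj₁; inj₂)
open import Function using (_∘_; id; flip; mk⇔; Equivalence)
open import Induction.WellFounded using (WellFounded; Acc; acc)
open import Relation.Binary using (Rel; IsPartialOrder)
open import Relation.Binary.PropositionalEquality using (refl; sym; subst)
import Relation.Binary.Construct.NonStrictToStrict as ToStrict
import Relation.Binary.Construct.On as On
open import Relation.Nullary using (¬_; Dec; yes; no; contradiction)
open import Relation.Nullary.Decidable
  using (⌊_⌋; map′; toWitness; fromWitness; decidable-stable; _×-dec_; _→-dec_; ¬?)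
open import Relation.Nullary.Decidable.Core using (T?)
open import Relation.Unary using (Pred; Decidable)
open import Relation.Unary.Properties using (⊆′-refl; ⊆′-trans)

open Equivalence using (to; from)
open Concept
open Filter

counterexample : ∀ {n p q} {P : Pred (Fin n) p} {Q : Pred (Fin n) q} →
                 Decidable P → Decidable Q →
                 ¬ (∀ i → P i → Q i) → ∃ λ i → P i × ¬ Q i
counterexample P? Q? ¬∀ = decidable-stable (any? λ i → P? i ×-dec ¬? (Q? i))
  λ none → ¬∀ λ i pᵢ → decidable-stable (Q? i) λ ¬qᵢ → none (i , pᵢ , ¬qᵢ)

module _ {n r p} {_⊏_ : Rel (Fin n) r} (⊏-noetherian : WellFounded (flip _⊏_))
         (_⊏?_ : ∀ i j → Dec (i ⊏ j)) {P : Pred (Fin n) p} (P? : Decidable P) where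

  maximal : ∀ {i} → P i → ∃ λ j → P j × (∀ k → P k → ¬ j ⊏ k)
  maximal {i} = go (⊏-noetherian i)
    where
    go : ∀ {i} → Acc (flip _⊏_) i → P i → ∃ λ j → P j × (∀ k → P k → ¬ j ⊏ k)
    go {i} (acc larger) pᵢ with any? (λ k → P? k ×-dec (i ⊏? k))
    ... | yes (k , pₖ , i⊏k) = go (larger i⊏k) pₖ
    ... | no none = i , pᵢ , λ k pₖ i⊏k → none (k , pₖ , i⊏k)

module ConceptLattice (K : Context) where

  infix 4 _⊑_ _⊏_

  -- x ⊑ y unfolds to inclusion of extents, so inequalities are composed with
  -- ⊆′-trans: a transitivity lemma stated for concepts would leave the
  -- intent and proof fields of an implicit middle concept unsolved.
  _⊑_ : Concept K → Concept K → Set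
  _⊑_ = _≤_ K

  ⊑-isPartialOrder : IsPartialOrder (_≈_ K) _⊑_
  ⊑-isPartialOrder = record
    { isPreorder = record
      { isEquivalence = record
        { refl  = ⊆′-refl , ⊆′-refl
        ; sym   = swap
        ; trans = λ (x⊑y , y⊑x) (y⊑z , z⊑y) → ⊆′-trans x⊑y y⊑z , ⊆′-trans z⊑y y⊑x
        }
      ; reflexive = proj₁
      ; trans     = ⊆′-trans
      }
    ; antisym = _,_
    }

  _⊏_ : Concept K → Concept K → Set
  _⊏_ = ToStrict._<_ (_≈_ K) _⊑_

  int-antitone : ∀ x y → x ⊑ y → ∀ n → T (int y n) → T (int x n)
  int-antitone x y x⊑y n n∈y =
    from (ext′≡int x n) λ g g∈x → to (ext′≡int y n) n∈y g (x⊑y g g∈x)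

  respects : {P : Concept K → Set} (P? : Decidable P) →
             (∀ {x y} → _≈_ K x y → P x → P y) →
             Respects K (λ x → ⌊ P? x ⌋)
  respects P? resp x y x≈y with P? x | P? y
  ... | yes _  | yes _  = refl
  ... | no _   | no _   = refl
  ... | yes px | no ¬py = contradiction (resp x≈y px) ¬py
  ... | no ¬px | yes py = contradiction (resp (swap x≈y) py) ¬px

  IsMeetIrr-resp-≈ : ∀ {x y} → _≈_ K x y → IsMeetIrr K x → IsMeetIrr K y
  IsMeetIrr-resp-≈ {x} {y} x≈y@(x⊑y , y⊑x) x-irr X X-resp (lower , greatest) =
    subst T (X-resp x y x≈y)
      (x-irr X X-resp ( (λ z z∈X → ⊆′-trans x⊑y (lower z z∈X))
                      , (λ z z-lower → ⊆′-trans (greatest z z-lower) y⊑x)))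

module FiniteContext {g m : ℕ} (I : Fin g → Fin m → Bool) where

  private
    K : Context
    K = Ctx g m I

  open ConceptLattice K public

  infix 4 _⊑?_ _≈?_ _⊏?_

  _⊑?_ : ∀ x y → Dec (x ⊑ y)
  x ⊑? y = all? λ a → T? (ext x a) →-dec T? (ext y a)

  _≈?_ : ∀ x y → Dec (_≈_ K x y)
  x ≈? y = x ⊑? y ×-dec y ⊑? x

  _⊏?_ : ∀ x y → Dec (x ⊏ y)
  x ⊏? y = x ⊑? y ×-dec ¬? (x ≈? y)

  int⇒⊑μ : ∀ c {n} → T (int c n) → c ⊑ μ I n
  int⇒⊑μ c n∈c a a∈c = to (int′≡ext c a) a∈c _ n∈c

  γ : Fin g → Concept K
  γ a = concept (λ b → ⌊ all? (λ n → T? (I a n) →-dec T? (I b n)) ⌋) (I a)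
    (λ n → mk⇔ (λ a∈n b b∈γa → toWitness b∈γa n a∈n)
               (λ all∈n → all∈n a (fromWitness λ _ → id)))
    (λ b → mk⇔ toWitness fromWitness)

  ∈γ : ∀ a → T (ext (γ a) a)
  ∈γ a = fromWitness λ _ → id

  γ-least : ∀ {a} c → T (ext c a) → γ a ⊑ c
  γ-least {a} c a∈c b b∈γa =
    from (int′≡ext c b) λ n n∈c → toWitness b∈γa n (to (int′≡ext c a) a∈c n n∈c)

  Separates : Fin g → Concept K → Set
  Separates a c = ¬ T (ext c a) × (∀ k → c ⊏ μ I k → T (I a k))

  separates? : ∀ a c → Dec (Separates a c)
  separates? a c = ¬? (T? (ext c a)) ×-dec all? λ k → c ⊏? μ I k →-dec T? (I a k)

  separates-above : ∀ {a} c y → Separates a c → c ⊏ y → T (ext y a)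
  separates-above {a} c y (_ , a∈above) (c⊑y , c≉y) =
    decidable-stable (T? (ext y a)) λ a∉y →
      let (n , n∈y , a∉n) = counterexample (T? ∘ int y) (T? ∘ I a) (a∉y ∘ from (int′≡ext y a))
          y⊑n = int⇒⊑μ y n∈y
          c⊏n = ⊆′-trans c⊑y y⊑n , λ (_ , n⊑c) → c≉y (c⊑y , ⊆′-trans y⊑n n⊑c)
      in a∉n (a∈above n c⊏n)

  separated⇒irreducible : ∀ {a c} → Separates a c → IsMeetIrr K c
  separated⇒irreducible {a} {c} a-sep X X-resp (lower , greatest) =
    decidable-stable (T? (X c)) λ c∉X →
      let c⊏X : ∀ y → T (X y) → c ⊏ y
          c⊏X y y∈X = lower y y∈X , λ c≈y → c∉X (subst T (sym (X-resp c y c≈y)) y∈X)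
          γa-lower : ∀ y → T (X y) → γ a ⊑ y
          γa-lower y y∈X = γ-least y (separates-above c y a-sep (c⊏X y y∈X))
      in proj₁ a-sep (greatest (γ a) γa-lower a (∈γ a))

  irreducible⇒separated : ∀ {c} → IsMeetIrr K c → ∃ λ a → Separates a c
  irreducible⇒separated {c} c-irr =
    decidable-stable (any? λ a → separates? a c) λ unseparated →
      let c⊏c = toWitness (c-irr strictlyAbove X-resp (lower , greatest unseparated))
      in proj₂ c⊏c (⊆′-refl , ⊆′-refl)
    where
    strictlyAbove : Concept K → Bool
    strictlyAbove y = ⌊ c ⊏? y ⌋
    X-resp : Respects K strictlyAbove
    X-resp = respects (c ⊏?_) λ (y⊑z , z⊑y) (c⊑y , c≉y) →
      ⊆′-trans c⊑y y⊑z , λ (c⊑z , z⊑c) → c≉y (c⊑y , ⊆′-trans y⊑z z⊑c)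
    lower : ∀ y → T (strictlyAbove y) → c ⊑ y
    lower y y∈X = proj₁ (toWitness y∈X)
    greatest : ¬ (∃ λ a → Separates a c) →
               ∀ z → (∀ y → T (strictlyAbove y) → z ⊑ y) → z ⊑ c
    greatest unseparated z z-lower a a∈z = decidable-stable (T? (ext c a)) λ a∉c →
      let (k , c⊏k , a∉k) = counterexample (λ k → c ⊏? μ I k) (T? ∘ I a)
                              λ above → unseparated (a , a∉c , above)
      in a∉k (z-lower (μ I k) (fromWitness c⊏k) a a∈z)

  IsMeetIrr? : ∀ c → Dec (IsMeetIrr K c)
  IsMeetIrr? c =
    map′ (separated⇒irreducible ∘ proj₂) irreducible⇒separated (any? λ a → separates? a c)

  irreducible⇒attribute : ∀ {c} → IsMeetIrr K c → ∃ λ n → _≈_ K c (μ I n)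
  irreducible⇒attribute {c} c-irr =
    let (n , _ , c≈n) = toWitness (c-irr attributesOf X-resp (lower , greatest)) in n , c≈n
    where
    attribute? : ∀ y → Dec (∃ λ n → T (int c n) × _≈_ K y (μ I n))
    attribute? y = any? λ n → T? (int c n) ×-dec y ≈? μ I n
    attributesOf : Concept K → Bool
    attributesOf y = ⌊ attribute? y ⌋
    X-resp : Respects K attributesOf
    X-resp = respects attribute? λ (y⊑z , z⊑y) (n , n∈c , y⊑n , n⊑y) →
      n , n∈c , ⊆′-trans z⊑y y⊑n , ⊆′-trans n⊑y y⊑z
    lower : ∀ y → T (attributesOf y) → c ⊑ y
    lower y y∈X =
      let (n , n∈c , _ , n⊑y) = toWitness y∈X in ⊆′-trans (int⇒⊑μ c n∈c) n⊑y
    greatest : ∀ z → (∀ y → T (attributesOf y) → z ⊑ y) → z ⊑ c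
    greatest z z-lower a a∈z = from (int′≡ext c a) λ n n∈c →
      z-lower (μ I n) (fromWitness (n , n∈c , ⊆′-refl , ⊆′-refl)) a a∈z

  irreducibleAbove : ∀ {a n} → ¬ T (I a n) →
                     ∃ λ k → μ I n ⊑ μ I k × ¬ T (I a k) × IsMIAttr I k
  irreducibleAbove {a} {n} a∉n =
    let (k , (n⊑k , a∉k) , k-maximal) =
          maximal attribute-⊏-noetherian (λ k k′ → μ I k ⊏? μ I k′) avoiding? (⊆′-refl , a∉n)
        a-separates-k : Separates a (μ I k)
        a-separates-k = a∉k , λ k′ k⊏k′ → decidable-stable (T? (I a k′)) λ a∉k′ →
          k-maximal k′ (⊆′-trans n⊑k (proj₁ k⊏k′) , a∉k′) k⊏k′
    in k , n⊑k , a∉k , separated⇒irreducible a-separates-k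
    where
    attribute-⊏-noetherian : WellFounded (flip λ k k′ → μ I k ⊏ μ I k′)
    attribute-⊏-noetherian = po-noetherian (On.isPartialOrder (μ I) ⊑-isPartialOrder)
    avoiding? : Decidable λ k → μ I n ⊑ μ I k × ¬ T (I a k)
    avoiding? k = μ I n ⊑? μ I k ×-dec ¬? (T? (I a k))

module BirkhoffCompletion {g m : ℕ} (I : Fin g → Fin m → Bool) where

  open FiniteContext I

  incidence? : ∀ o n → Dec (Context.I (BC I) o n)
  incidence? (inj₁ a)       n = T? (I a n)
  incidence? (inj₂ (k , _)) n = ¬? (μ I n ⊑? μ I k)

  filterOf : Concept (BC I) → Filter I
  filterOf x = record
    { mem = λ (c , _) → ⌊ any? (λ n → T? (int x n) ×-dec μ I n ⊑? c) ⌋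
    ; up  = λ _ _ c∈F c⊑d →
        let (n , n∈x , n⊑c) = toWitness c∈F in fromWitness (n , n∈x , ⊆′-trans n⊑c c⊑d)
    }

  filterOf-mono : ∀ x y → _≤_ (BC I) x y → _⊇_ I (filterOf x) (filterOf y)
  filterOf-mono x y x≤y _ c∈Fy =
    let (n , n∈y , n⊑c) = toWitness c∈Fy
    in fromWitness (n , ConceptLattice.int-antitone (BC I) x y x≤y n n∈y , n⊑c)

  filterOf-reflect : ∀ x y → _⊇_ I (filterOf x) (filterOf y) → _≤_ (BC I) x y
  filterOf-reflect x y Fx⊇Fy o o∈x = from (int′≡ext y o) (incident o o∈x)
    where
    generatorBelow : ∀ {n k} (k-irr : IsMIAttr I k) → T (int y n) → μ I n ⊑ μ I k →
                     ∃ λ n′ → T (int x n′) × μ I n′ ⊑ μ I k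
    generatorBelow {n} {k} k-irr n∈y n⊑k =
      toWitness (Fx⊇Fy (μ I k , k-irr) (fromWitness (n , n∈y , n⊑k)))
    incident : ∀ o → T (ext x o) → ∀ n → T (int y n) → Context.I (BC I) o n
    incident (inj₁ a) a∈x n n∈y = decidable-stable (T? (I a n)) λ a∉n →
      let (k , n⊑k , a∉k , k-irr) = irreducibleAbove a∉n
          (n′ , n′∈x , n′⊑k) = generatorBelow k-irr n∈y n⊑k
      in a∉k (n′⊑k a (to (int′≡ext x (inj₁ a)) a∈x n′ n′∈x))
    incident (inj₂ (k , k-irr)) k∈x n n∈y n⊑k =
      let (n′ , n′∈x , n′⊑k) = generatorBelow k-irr n∈y n⊑k
      in to (int′≡ext x (inj₂ (k , k-irr))) k∈x n′ n′∈x n′⊑k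

  Outside : Filter I → Fin m → Set
  Outside F k = Σ (IsMIAttr I k) λ k-irr → ¬ T (mem F (μ I k , k-irr))

  outside? : ∀ F k → Dec (Outside F k)
  outside? F k with IsMeetIrr? (μ I k)
  ... | yes k-irr = map′ (k-irr ,_) irrelevant (¬? (T? (mem F (μ I k , k-irr))))
    where
    irrelevant : Outside F k → ¬ T (mem F (μ I k , k-irr))
    irrelevant (k-irr′ , k∉F) k∈F = k∉F (up F (μ I k , k-irr) (μ I k , k-irr′) k∈F ⊆′-refl)
  ... | no ¬k-irr = no (¬k-irr ∘ proj₁)

  intentOf : Filter I → Fin m → Bool
  intentOf F n = ⌊ all? (λ k → outside? F k →-dec ¬? (μ I n ⊑? μ I k)) ⌋

  extentOf : Filter I → Context.G (BC I) → Bool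
  extentOf F o = ⌊ all? (λ n → T? (intentOf F n) →-dec incidence? o n) ⌋

  intentOf-closed : ∀ F n → (∀ o → T (extentOf F o) → Context.I (BC I) o n) →
                    T (intentOf F n)
  intentOf-closed F n incident = fromWitness λ k (k-irr , k∉F) →
    incident (inj₂ (k , k-irr)) (fromWitness λ n′ n′∈F → toWitness n′∈F k (k-irr , k∉F))

  conceptOf : Filter I → Concept (BC I)
  conceptOf F = concept (extentOf F) (intentOf F)
    (λ n → mk⇔ (λ n∈F o o∈F → toWitness o∈F n n∈F) (intentOf-closed F n))
    (λ o → mk⇔ toWitness fromWitness)

  filterOf-conceptOf-⊇ : ∀ F → _⊇_ I (filterOf (conceptOf F)) F
  filterOf-conceptOf-⊇ F (c , c-irr) c∈F =
    let (k , c⊑k , k⊑c) = irreducible⇒attribute c-irr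
        k∈intent = fromWitness λ k′ (k′-irr , k′∉F) k⊑k′ →
          k′∉F (up F (c , c-irr) (μ I k′ , k′-irr) c∈F (⊆′-trans c⊑k k⊑k′))
    in fromWitness (k , k∈intent , k⊑c)

  filterOf-conceptOf-⊆ : ∀ F → _⊇_ I F (filterOf (conceptOf F))
  filterOf-conceptOf-⊆ F (c , c-irr) c∈F′ = decidable-stable (T? (mem F (c , c-irr))) λ c∉F →
    let (n , n∈intent , n⊑c) = toWitness c∈F′
        (k , c⊑k , k⊑c) = irreducible⇒attribute c-irr
        k-irr = IsMeetIrr-resp-≈ (c⊑k , k⊑c) c-irr
        k-outside = k-irr , λ k∈F → c∉F (up F (μ I k , k-irr) (c , c-irr) k∈F k⊑c)
    in toWitness n∈intent k k-outside (⊆′-trans n⊑c c⊑k)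

theorem5 : (g m : ℕ) (I : Fin g → Fin m → Bool) →
    OrderIso (_≤_ (BC I)) (_⊇_ I)
theorem5 g m I = record
  { to      = filterOf
  ; mono    = filterOf-mono
  ; reflect = filterOf-reflect
  ; onto    = λ F → conceptOf F , filterOf-conceptOf-⊇ F , filterOf-conceptOf-⊆ F
  }
  where open BirkhoffCompletion I
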